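{- Let $(\mathbf{M},\mathbf{N})$ be an $\mathrm{IMLU}$-category with data $U,\mathbf{T},\iota,\mathbf{P},\mu$ and $m_{\subseteq^\mathbf{T}_A}$. Then: (a) for any morphism $f:A\to B$ in $\mathbf{N}$, $f$ is monic in $\mathbf{N}$ iff $f$ is monic in $\mathbf{M}$; (b) the inclusion functor of $\mathbf{N}$ into $\mathbf{M}$ reflects finite limits; (c) for every object $A$ of $\mathbf{N}$, $\mathbf{P}A$ together with $m_{\subseteq^\mathbf{T}_A}$ is a power object of $\mathbf{T}A$ in $\mathbf{N}$; (d) $\mathbf{T}:\mathbf{M}\to\mathbf{M}$ is a Heyting endofunctor, and if $(\mathbf{M},\mathbf{N})$ is an $\mathrm{MLU}$-category it is a Boolean endofunctor; (e) $\mathbf{T}:\mathbf{N}\to\mathbf{N}$ preserves finite limits.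
   Context: Heyting category: finite limits, images, covers stable under pullback, each subobject poset $\mathrm{Sub}(X)$ a join-semilattice, each pullback map $f^*$ preserving finite joins with adjoints $\exists_f\dashv f^*\dashv\forall_f$; Boolean if each $\mathrm{Sub}(X)$ is a Boolean algebra. A Heyting (Boolean) functor preserves all this structure. An $\mathrm{IMLU}$-category is a pair $(\mathbf{M},\mathbf{N})$ of Heyting categories with $\mathbf{N}$ a conservative (isomorphism-reflecting) Heyting subcategory of $\mathbf{M}$ (inclusion is a Heyting functor), together with: an object $U$ of $\mathbf{N}$ such that every object of $\mathbf{N}$ has a mono in $\mathbf{N}$ into $U$; an endofunctor $\mathbf{T}$ of $\mathbf{M}$ restricting to an endofunctor of $\mathbf{N}$ and a natural isomorphism $\iota:\mathrm{id}_\mathbf{M}\to\mathbf{T}$; an endofunctor $\mathbf{P}$ of $\mathbf{N}$ such that for each object $A$ of $\mathbf{N}$ there is $m_{\subseteq^\mathbf{T}_A}:\subseteq^\mathbf{T}_A\to\mathbf{T}A\times\mathbf{P}A$ in $\mathbf{N}$, monic in $\mathbf{M}$, such that for each $r:R\to\mathbf{T}A\times B$ in $\mathbf{N}$ monic in $\mathbf{M}$ there is $\chi:B\to\mathbf{P}A$ in $\mathbf{N}$ which is the unique morphism of $\mathbf{M}$ for which $r$ is a pullback in $\mathbf{M}$ of $m_{\subseteq^\mathbf{T}_A}$ along $\mathrm{id}\times\chi$; and a natural isomorphism $\mu:\mathbf{P}\mathbf{T}\to\mathbf{T}\mathbf{P}$ on $\mathbf{N}$. An $\mathrm{MLU}$-category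 is the same with Boolean categories. A functor $\mathbf{F}:\mathbf{B}\to\mathbf{C}$ reflects finite limits if for every finite diagram $\mathbf{D}$ in $\mathbf{B}$ and cone $\Lambda$ of $\mathbf{D}$ in $\mathbf{B}$, if $\mathbf{F}\Lambda$ is a limit of $\mathbf{F}\circ\mathbf{D}$ then $\Lambda$ is a limit of $\mathbf{D}$. A power object of $X$ in $\mathbf{N}$ is an object $Q$ with a mono $m:E\rightarrowtail X\times Q$ such that for each mono $r:R\rightarrowtail X\times B$ there is a unique $\chi:B\to Q$ such that $r$ is a pullback of $m$ along $\mathrm{id}\times\chi$. -}

module Defs where

open import Level using (Level; _⊔_; suc; 0ℓ)
open import Data.Nat using (ℕ)
open import Data.Fin using (Fin)
open import Data.Product using (Σ; _×_; _,_; proj₁; proj₂)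
open import Function.Bundles using (_↔_)
open import Relation.Binary.PropositionalEquality
  using (_≡_; refl; sym; trans; cong; cong₂; subst₂)

record Category (o ℓ : Level) : Set (suc (o ⊔ ℓ)) where
  infixr 9 _∘_
  field
    Obj : Set o
    Hom : Obj → Obj → Set ℓ
    id  : ∀ {A} → Hom A A
    _∘_ : ∀ {A B C} → Hom B C → Hom A B → Hom A C
    assoc     : ∀ {A B C D} (h : Hom C D) (g : Hom B C) (f : Hom A B) →
                (h ∘ g) ∘ f ≡ h ∘ (g ∘ f)
    identityˡ : ∀ {A B} (f : Hom A B) → id ∘ f ≡ f
    identityʳ : ∀ {A B} (f : Hom A B) → f ∘ id ≡ f

record Functor {o ℓ o′ ℓ′} (C : Category o ℓ) (D : Category o′ ℓ′)
       : Set (o ⊔ ℓ ⊔ o′ ⊔ ℓ′) where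
  private
    module C = Category C
    module D = Category D
  field
    F₀ : C.Obj → D.Obj
    F₁ : ∀ {A B} → C.Hom A B → D.Hom (F₀ A) (F₀ B)
    identity     : ∀ {A} → F₁ (C.id {A}) ≡ D.id
    homomorphism : ∀ {A B C′} (g : C.Hom B C′) (f : C.Hom A B) →
                   F₁ (g C.∘ f) ≡ F₁ g D.∘ F₁ f

open Functor public

idF : ∀ {o ℓ} {C : Category o ℓ} → Functor C C
idF {C = C} = record
  { F₀ = λ A → A ; F₁ = λ f → f ; identity = refl ; homomorphism = λ _ _ → refl }

infixr 9 _∘F_
_∘F_ : ∀ {o₁ ℓ₁ o₂ ℓ₂ o₃ ℓ₃} {B : Category o₁ ℓ₁} {C : Category o₂ ℓ₂}
         {D : Category o₃ ℓ₃} → Functor C D → Functor B C → Functor B D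
_∘F_ {D = D} G F = record
  { F₀ = λ A → F₀ G (F₀ F A)
  ; F₁ = λ f → F₁ G (F₁ F f)
  ; identity = trans (cong (F₁ G) (identity F)) (identity G)
  ; homomorphism = λ g f →
      trans (cong (F₁ G) (homomorphism F g f))
            (homomorphism G (F₁ F g) (F₁ F f))
  }

record NatIso {o ℓ o′ ℓ′} {C : Category o ℓ} {D : Category o′ ℓ′}
       (F G : Functor C D) : Set (o ⊔ ℓ ⊔ o′ ⊔ ℓ′) where
  private
    module C = Category C
    module D = Category D
  field
    η    : ∀ A → D.Hom (F₀ F A) (F₀ G A)
    η⁻¹  : ∀ A → D.Hom (F₀ G A) (F₀ F A)
    isoˡ : ∀ A → η⁻¹ A D.∘ η A ≡ D.id
    isoʳ : ∀ A → η A D.∘ η⁻¹ A ≡ D.id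
    natural : ∀ {A B} (f : C.Hom A B) → η B D.∘ F₁ F f ≡ F₁ G f D.∘ η A

module _ {o ℓ} (C : Category o ℓ) where
  open Category C

  IsMono : ∀ {A B} → Hom A B → Set (o ⊔ ℓ)
  IsMono {A} f = ∀ {Z} (g h : Hom Z A) → f ∘ g ≡ f ∘ h → g ≡ h

  IsIso : ∀ {A B} → Hom A B → Set ℓ
  IsIso {A} {B} f = Σ (Hom B A) λ g → (g ∘ f ≡ id) × (f ∘ g ≡ id)

  record IsPullbackSquare {P A B X} (p : Hom P A) (q : Hom P B)
         (f : Hom A X) (g : Hom B X) : Set (o ⊔ ℓ) where
    field
      commute   : f ∘ p ≡ g ∘ q
      universal : ∀ {Z} (x : Hom Z A) (y : Hom Z B) → f ∘ x ≡ g ∘ y →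
                  Σ (Hom Z P) λ h → (p ∘ h ≡ x) × (q ∘ h ≡ y) ×
                    (∀ h′ → p ∘ h′ ≡ x → q ∘ h′ ≡ y → h′ ≡ h)

  record Product (X Y : Obj) : Set (o ⊔ ℓ) where
    field
      obj : Obj
      π₁  : Hom obj X
      π₂  : Hom obj Y
      universal : ∀ {Z} (x : Hom Z X) (y : Hom Z Y) →
                  Σ (Hom Z obj) λ h → (π₁ ∘ h ≡ x) × (π₂ ∘ h ≡ y) ×
                    (∀ h′ → π₁ ∘ h′ ≡ x → π₂ ∘ h′ ≡ y → h′ ≡ h)

  -- Here k plays the role of id × χ
  -- (it is characterised by q₁ ∘ k ≡ p₁ and q₂ ∘ k ≡ χ ∘ p₂).
  PullbackAlongPair : ∀ {X B Q XB XQ R E}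
    (p₁ : Hom XB X) (p₂ : Hom XB B) (q₁ : Hom XQ X) (q₂ : Hom XQ Q)
    (χ : Hom B Q) (r : Hom R XB) (m : Hom E XQ) → Set (o ⊔ ℓ)
  PullbackAlongPair {XB = XB} {XQ} {R} {E} p₁ p₂ q₁ q₂ χ r m =
    Σ (Hom XB XQ) λ k → ((q₁ ∘ k ≡ p₁) × (q₂ ∘ k ≡ χ ∘ p₂)) ×
      Σ (Hom R E) λ s → IsPullbackSquare r s k m

  IsPowerObject : (X Q : Obj) (XQ : Product X Q) {E : Obj}
                  (m : Hom E (Product.obj XQ)) → Set (o ⊔ ℓ)
  IsPowerObject X Q XQ m =
    IsMono m ×
    (∀ (B : Obj) (XB : Product X B) {R : Obj} (r : Hom R (Product.obj XB)) →
       IsMono r →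
       Σ (Hom B Q) λ χ →
         PullbackAlongPair (Product.π₁ XB) (Product.π₂ XB)
                           (Product.π₁ XQ) (Product.π₂ XQ) χ r m ×
         (∀ (χ′ : Hom B Q) →
            PullbackAlongPair (Product.π₁ XB) (Product.π₂ XB)
                              (Product.π₁ XQ) (Product.π₂ XQ) χ′ r m →
            χ′ ≡ χ))

  IsCover : ∀ {A B} → Hom A B → Set (o ⊔ ℓ)
  IsCover {A} {B} f = ∀ {M} (m : Hom M B) (g : Hom A M) → IsMono m →
                      m ∘ g ≡ f → IsIso m

  record Sub (X : Obj) : Set (o ⊔ ℓ) where
    constructor sub
    field
      dom  : Obj
      arr  : Hom dom X
      mono : IsMono arr

  open Sub public

  _≤S_ : ∀ {X} → Sub X → Sub X → Set ℓ
  a ≤S b = Σ (Hom (dom a) (dom b)) λ h → arr b ∘ h ≡ arr a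

  PullbackOf : ∀ {X Y} → Hom X Y → Sub Y → Sub X → Set (o ⊔ ℓ)
  PullbackOf f b p = Σ (Hom (dom p) (dom b)) λ q →
                       IsPullbackSquare (arr p) q f (arr b)

  IsImage : ∀ {A X} → Hom A X → Sub X → Set (o ⊔ ℓ)
  IsImage {A} f m = (Σ (Hom A (dom m)) λ g → arr m ∘ g ≡ f) ×
                    (∀ n → (Σ (Hom A (dom n)) λ g → arr n ∘ g ≡ f) → m ≤S n)

  IsExists : ∀ {X Y} → Hom X Y → Sub X → Sub Y → Set (o ⊔ ℓ)
  IsExists f a e = ∀ b p → PullbackOf f b p →
                   (e ≤S b → a ≤S p) × (a ≤S p → e ≤S b)

  IsForall : ∀ {X Y} → Hom X Y → Sub X → Sub Y → Set (o ⊔ ℓ)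
  IsForall f a q = ∀ b p → PullbackOf f b p →
                   (p ≤S a → b ≤S q) × (b ≤S q → p ≤S a)

module _ {a r} {S : Set a} (_≤_ : S → S → Set r) where

  IsLeast : S → Set (a ⊔ r)
  IsLeast z = ∀ b → z ≤ b

  IsGreatest : S → Set (a ⊔ r)
  IsGreatest t = ∀ b → b ≤ t

  IsJoin : S → S → S → Set (a ⊔ r)
  IsJoin x y j = (x ≤ j) × (y ≤ j) × (∀ c → x ≤ c → y ≤ c → j ≤ c)

  IsMeet : S → S → S → Set (a ⊔ r)
  IsMeet x y m = (m ≤ x) × (m ≤ y) × (∀ c → c ≤ x → c ≤ y → c ≤ m)

  IsComplement : S → S → Set (a ⊔ r)
  IsComplement x c = (∀ m → IsMeet x c m → IsLeast m) ×
                     (∀ j → IsJoin x c j → IsGreatest j)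

  record IsBooleanAlgebra : Set (a ⊔ r) where
    field
      top    : Σ S IsGreatest
      bottom : Σ S IsLeast
      meet   : ∀ x y → Σ S (IsMeet x y)
      join   : ∀ x y → Σ S (IsJoin x y)
      distrib : ∀ x y z yz xyz xy xz d →
                IsJoin y z yz → IsMeet x yz xyz →
                IsMeet x y xy → IsMeet x z xz → IsJoin xy xz d →
                xyz ≤ d
      complement : ∀ x → Σ S (IsComplement x)

record FiniteCategory : Set₁ where
  field
    cat    : Category 0ℓ 0ℓ
    size   : ℕ
    objFin : Category.Obj cat ↔ Fin size
    homCount : Category.Obj cat → Category.Obj cat → ℕ
    homFin : ∀ i j → Category.Hom cat i j ↔ Fin (homCount i j)

open FiniteCategory public using (cat)

module _ {o ℓ} {J : Category 0ℓ 0ℓ} {C : Category o ℓ} where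
  private
    module J = Category J
  open Category C

  record Cone (D : Functor J C) : Set (o ⊔ ℓ) where
    field
      apex : Obj
      leg  : ∀ j → Hom apex (F₀ D j)
      comm : ∀ {i j} (u : J.Hom i j) → F₁ D u ∘ leg i ≡ leg j

  open Cone public

  IsLimit : {D : Functor J C} → Cone D → Set (o ⊔ ℓ)
  IsLimit {D} L = ∀ (K : Cone D) →
    Σ (Hom (apex K) (apex L)) λ h → (∀ j → leg L j ∘ h ≡ leg K j) ×
      (∀ h′ → (∀ j → leg L j ∘ h′ ≡ leg K j) → h′ ≡ h)

mapCone : ∀ {o ℓ o′ ℓ′} {J : Category 0ℓ 0ℓ} {C : Category o ℓ}
          {D : Category o′ ℓ′} (F : Functor C D) {G : Functor J C} →
          Cone G → Cone (F ∘F G)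
mapCone F {G} K = record
  { apex = F₀ F (apex K)
  ; leg  = λ j → F₁ F (leg K j)
  ; comm = λ u → trans (sym (homomorphism F _ _)) (cong (F₁ F) (comm K u))
  }

HasFiniteLimits : ∀ {o ℓ} → Category o ℓ → Set (suc 0ℓ ⊔ o ⊔ ℓ)
HasFiniteLimits C = ∀ (J : FiniteCategory) (D : Functor (cat J) C) →
                    Σ (Cone D) IsLimit

module _ {o ℓ o′ ℓ′} {B : Category o ℓ} {C : Category o′ ℓ′} where

  PreservesFiniteLimits : Functor B C → Set (suc 0ℓ ⊔ o ⊔ ℓ ⊔ o′ ⊔ ℓ′)
  PreservesFiniteLimits F = ∀ (J : FiniteCategory) (D : Functor (cat J) B)
    (Λ : Cone D) → IsLimit Λ → IsLimit (mapCone F Λ)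

  ReflectsFiniteLimits : Functor B C → Set (suc 0ℓ ⊔ o ⊔ ℓ ⊔ o′ ⊔ ℓ′)
  ReflectsFiniteLimits F = ∀ (J : FiniteCategory) (D : Functor (cat J) B)
    (Λ : Cone D) → IsLimit (mapCone F Λ) → IsLimit Λ

record HeytingCategory {o ℓ} (C : Category o ℓ) : Set (suc (o ⊔ ℓ)) where
  open Category C
  field
    finiteLimits : HasFiniteLimits C
    images       : ∀ {A X} (f : Hom A X) → Σ (Sub C X) (IsImage C f)
    coverStable  : ∀ {P A B X} (p : Hom P A) (q : Hom P B)
                     (f : Hom A X) (g : Hom B X) →
                   IsPullbackSquare C p q f g → IsCover C g → IsCover C p
    bottom : ∀ X → Σ (Sub C X) (IsLeast (_≤S_ C))
    join   : ∀ {X} (a b : Sub C X) → Σ (Sub C X) (IsJoin (_≤S_ C) a b)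
    pullbackBottom : ∀ {X Y} (f : Hom X Y) (z : Sub C Y) (p : Sub C X) →
                     IsLeast (_≤S_ C) z → PullbackOf C f z p →
                     IsLeast (_≤S_ C) p
    pullbackJoin : ∀ {X Y} (f : Hom X Y) (a b j : Sub C Y)
                     (pa pb pj : Sub C X) →
                   IsJoin (_≤S_ C) a b j →
                   PullbackOf C f a pa → PullbackOf C f b pb →
                   PullbackOf C f j pj →
                   IsJoin (_≤S_ C) pa pb pj
    existsAdj : ∀ {X Y} (f : Hom X Y) (a : Sub C X) → Σ (Sub C Y) (IsExists C f a)
    forallAdj : ∀ {X Y} (f : Hom X Y) (a : Sub C X) → Σ (Sub C Y) (IsForall C f a)

IsBoolean : ∀ {o ℓ} → Category o ℓ → Set (o ⊔ ℓ)
IsBoolean C = ∀ X → IsBooleanAlgebra (_≤S_ C {X})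

module _ {o ℓ o′ ℓ′} {C : Category o ℓ} {D : Category o′ ℓ′} where
  private
    module C = Category C
    module D = Category D

  mapSub : (F : Functor C D) →
           (∀ {A B} (f : C.Hom A B) → IsMono C f → IsMono D (F₁ F f)) →
           ∀ {X} → Sub C X → Sub D (F₀ F X)
  mapSub F pm a = sub (F₀ F (dom a)) (F₁ F (arr a)) (pm (arr a) (mono a))

  record HeytingFunctor (F : Functor C D) : Set (suc (o ⊔ ℓ ⊔ o′ ⊔ ℓ′)) where
    field
      preservesFiniteLimits : PreservesFiniteLimits F
      preservesMono   : ∀ {A B} (f : C.Hom A B) → IsMono C f →
                        IsMono D (F₁ F f)
      preservesCovers : ∀ {A B} (f : C.Hom A B) → IsCover C f →
                        IsCover D (F₁ F f)
      preservesImages : ∀ {A X} (f : C.Hom A X) (m : Sub C X) →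
                        IsImage C f m → IsImage D (F₁ F f) (mapSub F preservesMono m)
      preservesBottom : ∀ {X} (z : Sub C X) → IsLeast (_≤S_ C) z →
                        IsLeast (_≤S_ D) (mapSub F preservesMono z)
      preservesJoin   : ∀ {X} (a b j : Sub C X) → IsJoin (_≤S_ C) a b j →
                        IsJoin (_≤S_ D) (mapSub F preservesMono a)
                          (mapSub F preservesMono b) (mapSub F preservesMono j)
      preservesExists : ∀ {X Y} (f : C.Hom X Y) (a : Sub C X) (e : Sub C Y) →
                        IsExists C f a e →
                        IsExists D (F₁ F f) (mapSub F preservesMono a)
                          (mapSub F preservesMono e)
      preservesForall : ∀ {X Y} (f : C.Hom X Y) (a : Sub C X) (q : Sub C Y) →
                        IsForall C f a q →
                        IsForall D (F₁ F f) (mapSub F preservesMono a)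
                          (mapSub F preservesMono q)

  record BooleanFunctor (F : Functor C D) : Set (suc (o ⊔ ℓ ⊔ o′ ⊔ ℓ′)) where
    field
      heyting : HeytingFunctor F
      preservesComplement : ∀ {X} (a c : Sub C X) →
        IsComplement (_≤S_ C) a c →
        IsComplement (_≤S_ D)
          (mapSub F (HeytingFunctor.preservesMono heyting) a)
          (mapSub F (HeytingFunctor.preservesMono heyting) c)

record Restricts {o ℓ} {M N : Category o ℓ} (I : Functor N M)
       (T : Functor M M) (TN : Functor N N) : Set (o ⊔ ℓ) where
  field
    obj-eq : ∀ A → F₀ T (F₀ I A) ≡ F₀ I (F₀ TN A)
    hom-eq : ∀ {A B} (f : Category.Hom N A B) →
             subst₂ (Category.Hom M) (obj-eq A) (obj-eq B) (F₁ T (F₁ I f))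
               ≡ F₁ I (F₁ TN f)

record IMLU (o ℓ : Level) : Set (suc (o ⊔ ℓ)) where
  field
    M N : Category o ℓ
    heytingM : HeytingCategory M
    heytingN : HeytingCategory N
    I : Functor N M
    I-injective : ∀ {A B} → F₀ I A ≡ F₀ I B → A ≡ B
    I-faithful  : ∀ {A B} (f g : Category.Hom N A B) → F₁ I f ≡ F₁ I g → f ≡ g
    I-conservative : ∀ {A B} (f : Category.Hom N A B) →
                     IsIso M (F₁ I f) → IsIso N f
    I-heyting : HeytingFunctor I
    U : Category.Obj N
    U-univ : ∀ A → Σ (Category.Hom N A U) (IsMono N)
    T  : Functor M M
    TN : Functor N N
    T-restricts : Restricts I T TN
    ι  : NatIso idF T
    P : Functor N N
    prodTP : ∀ A → Product N (F₀ TN A) (F₀ P A)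
    ⊆T : Category.Obj N → Category.Obj N
    m⊆T : ∀ A → Category.Hom N (⊆T A) (Product.obj (prodTP A))
    m⊆T-mono : ∀ A → IsMono M (F₁ I (m⊆T A))
    comprehension : ∀ A B (XB : Product N (F₀ TN A) B) {R}
      (r : Category.Hom N R (Product.obj XB)) → IsMono M (F₁ I r) →
      Σ (Category.Hom N B (F₀ P A)) λ χ →
        PullbackAlongPair M (F₁ I (Product.π₁ XB)) (F₁ I (Product.π₂ XB))
          (F₁ I (Product.π₁ (prodTP A))) (F₁ I (Product.π₂ (prodTP A)))
          (F₁ I χ) (F₁ I r) (F₁ I (m⊆T A)) ×
        (∀ (χ′ : Category.Hom M (F₀ I B) (F₀ I (F₀ P A))) →
          PullbackAlongPair M (F₁ I (Product.π₁ XB)) (F₁ I (Product.π₂ XB))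
            (F₁ I (Product.π₁ (prodTP A))) (F₁ I (Product.π₂ (prodTP A)))
            χ′ (F₁ I r) (F₁ I (m⊆T A)) →
          χ′ ≡ F₁ I χ)
    μ : NatIso (P ∘F TN) (TN ∘F P)

module Submission where

-- Little of the proof is specific to IMLU-categories; it rests on general
-- facts about a functor F : B → C, each proved at its natural generality:
--   * a faithful functor reflects monos, giving (a);
--   * if B has finite limits and F is conservative and preserves them, then
--     F reflects finite limits (b); moreover, if F r factors through a mono
--     F a in C then r factors through a in B, so a pullback square in C
--     built on edges from B lifts to B.  This turns the classifying squares
--     that the comprehension axiom provides in M into classifying squares
--     in N, and uniqueness descends along the faithful I, giving (c);
--   * a functor naturally isomorphic to the identity acts on each subobject
--     preorder as an order equivalence compatible with pulling back, and
--     so is a Boolean (in particular Heyting) functor, giving (d).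
-- For (e), T ∘ I preserves finite limits and is isomorphic to I ∘ TN via
-- the restriction equations, so I reflects limits of TN-images.

open import Defs
open import Level using (0ℓ; _⊔_)
open import Data.Nat using (ℕ)
open import Data.Fin using (Fin; zero; suc)
open import Data.Product using (Σ; _×_; _,_; proj₁; proj₂)
open import Function.Bundles using (mk↔ₛ′)
open import Relation.Binary.PropositionalEquality
  using (_≡_; refl; sym; trans; cong; subst; subst₂; module ≡-Reasoning)

module CategoryFacts {o ℓ} (C : Category o ℓ) where
  open Category C
  open ≡-Reasoning

  extendʳ : ∀ {A B X Y} {f : Hom X Y} {g : Hom B X} {h : Hom B Y} (k : Hom A B) →
            f ∘ g ≡ h → f ∘ (g ∘ k) ≡ h ∘ k
  extendʳ {f = f} {g} k e = trans (sym (assoc f g k)) (cong (_∘ k) e)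

  cancelˡ : ∀ {A B X} {g : Hom X B} {f : Hom B X} (h : Hom A B) →
            g ∘ f ≡ id → g ∘ (f ∘ h) ≡ h
  cancelˡ h e = trans (extendʳ h e) (identityˡ h)

  cancelʳ : ∀ {A B X} {g : Hom X B} {f : Hom B X} (h : Hom B A) →
            g ∘ f ≡ id → (h ∘ g) ∘ f ≡ h
  cancelʳ {g = g} {f} h e = trans (assoc h g f) (trans (cong (h ∘_) e) (identityʳ h))

  retraction⇒mono : ∀ {A B} {g : Hom A B} (k : Hom B A) → k ∘ g ≡ id → IsMono C g
  retraction⇒mono {g = g} k e x y p = begin
    x             ≡⟨ sym (cancelˡ x e) ⟩
    k ∘ (g ∘ x)   ≡⟨ cong (k ∘_) p ⟩
    k ∘ (g ∘ y)   ≡⟨ cancelˡ y e ⟩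
    y             ∎

  iso⇒mono : ∀ {A B} {f : Hom A B} → IsIso C f → IsMono C f
  iso⇒mono (g , gf , _) = retraction⇒mono g gf

  ∘-mono : ∀ {A B X} {f : Hom B X} {g : Hom A B} →
           IsMono C f → IsMono C g → IsMono C (f ∘ g)
  ∘-mono fm gm x y p = gm x y (fm _ _ (trans (sym (assoc _ _ _)) (trans p (assoc _ _ _))))

  ∘-iso : ∀ {A B X} {f : Hom B X} {g : Hom A B} →
          IsIso C f → IsIso C g → IsIso C (f ∘ g)
  ∘-iso {f = f} {g} (f⁻¹ , f⁻¹f , ff⁻¹) (g⁻¹ , g⁻¹g , gg⁻¹) =
    g⁻¹ ∘ f⁻¹ ,
    trans (assoc _ _ _) (trans (cong (g⁻¹ ∘_) (cancelˡ g f⁻¹f)) g⁻¹g) ,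
    trans (assoc _ _ _) (trans (cong (f ∘_) (cancelˡ f⁻¹ gg⁻¹)) ff⁻¹)

  cover-∘-iso : ∀ {A B X} {f : Hom B X} {u : Hom A B} →
                IsCover C f → IsIso C u → IsCover C (f ∘ u)
  cover-∘-iso {f = f} fc (u⁻¹ , _ , uu⁻¹) m g mm e =
    fc m (g ∘ u⁻¹) mm (trans (sym (assoc _ _ _)) (trans (cong (_∘ u⁻¹) e) (cancelʳ f uu⁻¹)))

  iso-∘-cover : ∀ {A B X} {v : Hom B X} {f : Hom A B} →
                IsIso C v → IsCover C f → IsCover C (v ∘ f)
  iso-∘-cover {v = v} {f} (v⁻¹ , v⁻¹v , vv⁻¹) fc m g mm e =
    subst (IsIso C) (cancelˡ m vv⁻¹) (∘-iso (v⁻¹ , v⁻¹v , vv⁻¹) v⁻¹m-iso)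
    where
      -- v⁻¹ ∘ m is a mono through which f factors, hence invertible.
      v⁻¹m-iso : IsIso C (v⁻¹ ∘ m)
      v⁻¹m-iso = fc (v⁻¹ ∘ m) g (∘-mono (iso⇒mono (v , vv⁻¹ , v⁻¹v)) mm)
        (trans (assoc _ _ _) (trans (cong (v⁻¹ ∘_) e) (cancelˡ f v⁻¹v)))

  ≤S-trans : ∀ {X} {a b c : Sub C X} → _≤S_ C a b → _≤S_ C b c → _≤S_ C a c
  ≤S-trans (h , e) (h′ , e′) = h′ ∘ h , trans (sym (assoc _ _ _)) (trans (cong (_∘ h) e′) e)

  pullback-jointly-monic : ∀ {P A B X} {p : Hom P A} {q : Hom P B} {f : Hom A X} {g : Hom B X} →
    IsPullbackSquare C p q f g → ∀ {Z} (x y : Hom Z P) →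
    p ∘ x ≡ p ∘ y → q ∘ x ≡ q ∘ y → x ≡ y
  pullback-jointly-monic {p = p} {q} {f} {g} sq x y px≡py qx≡qy =
    trans (factors-uniquely x refl refl) (sym (factors-uniquely y (sym px≡py) (sym qx≡qy)))
    where
      open IsPullbackSquare sq
      mediator = universal (p ∘ x) (q ∘ x) (trans (extendʳ x commute) (assoc g q x))
      factors-uniquely = proj₂ (proj₂ (proj₂ mediator))

  pullback-of-mono : ∀ {P A B X} {p : Hom P A} {q : Hom P B} {f : Hom A X} {g : Hom B X} →
                     IsPullbackSquare C p q f g → IsMono C g → IsMono C p
  pullback-of-mono {p = p} {q} {f} {g} sq gm x y px≡py =
    pullback-jointly-monic sq x y px≡py (gm _ _ gqx≡gqy)
    where
      open IsPullbackSquare sq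
      gqx≡gqy : g ∘ (q ∘ x) ≡ g ∘ (q ∘ y)
      gqx≡gqy = begin
        g ∘ (q ∘ x)   ≡⟨ extendʳ x (sym commute) ⟩
        (f ∘ p) ∘ x   ≡⟨ assoc f p x ⟩
        f ∘ (p ∘ x)   ≡⟨ cong (f ∘_) px≡py ⟩
        f ∘ (p ∘ y)   ≡⟨ sym (assoc f p y) ⟩
        (f ∘ p) ∘ y   ≡⟨ sym (extendʳ y (sym commute)) ⟩
        g ∘ (q ∘ y)   ∎

  pullback-transport : ∀ {P A A′ B X X′} {p : Hom P A} {q : Hom P B} {f : Hom A X}
    {g : Hom B X} {f′ : Hom A′ X′} {u : Hom A A′} {v : Hom X X′} →
    IsIso C u → IsMono C v → f′ ∘ u ≡ v ∘ f →
    IsPullbackSquare C p q f g → IsPullbackSquare C (u ∘ p) q f′ (v ∘ g)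
  pullback-transport {p = p} {q} {f} {g} {f′} {u} {v} (u⁻¹ , u⁻¹u , uu⁻¹) vm square sq =
    record { commute = commute′ ; universal = universal′ }
    where
      open IsPullbackSquare sq
      commute′ : f′ ∘ (u ∘ p) ≡ (v ∘ g) ∘ q
      commute′ = begin
        f′ ∘ (u ∘ p)   ≡⟨ extendʳ p square ⟩
        (v ∘ f) ∘ p    ≡⟨ assoc v f p ⟩
        v ∘ (f ∘ p)    ≡⟨ cong (v ∘_) commute ⟩
        v ∘ (g ∘ q)    ≡⟨ sym (assoc v g q) ⟩
        (v ∘ g) ∘ q    ∎
      universal′ : ∀ {Z} (x : Hom Z _) (y : Hom Z _) → f′ ∘ x ≡ (v ∘ g) ∘ y →
        Σ (Hom Z _) λ h → ((u ∘ p) ∘ h ≡ x) × (q ∘ h ≡ y) ×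
          (∀ h′ → (u ∘ p) ∘ h′ ≡ x → q ∘ h′ ≡ y → h′ ≡ h)
      universal′ x y e = h , (trans (assoc u p h) (trans (cong (u ∘_) ph) (cancelˡ x uu⁻¹))) ,
                         qh , λ h′ e₁ e₂ → unique h′ (u⁻¹-side h′ e₁) e₂
        where
          -- (u⁻¹ ∘ x, y) is a cone over (f, g), because v is monic
          cone : f ∘ (u⁻¹ ∘ x) ≡ g ∘ y
          cone = vm _ _ (begin
            v ∘ (f ∘ (u⁻¹ ∘ x))    ≡⟨ sym (assoc v f _) ⟩
            (v ∘ f) ∘ (u⁻¹ ∘ x)    ≡⟨ cong (_∘ (u⁻¹ ∘ x)) (sym square) ⟩
            (f′ ∘ u) ∘ (u⁻¹ ∘ x)   ≡⟨ assoc f′ u _ ⟩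
            f′ ∘ (u ∘ (u⁻¹ ∘ x))   ≡⟨ cong (f′ ∘_) (cancelˡ x uu⁻¹) ⟩
            f′ ∘ x                 ≡⟨ e ⟩
            (v ∘ g) ∘ y            ≡⟨ assoc v g y ⟩
            v ∘ (g ∘ y)            ∎)
          U = universal (u⁻¹ ∘ x) y cone
          h = proj₁ U
          ph = proj₁ (proj₂ U)
          qh = proj₁ (proj₂ (proj₂ U))
          unique = proj₂ (proj₂ (proj₂ U))
          u⁻¹-side : ∀ h′ → (u ∘ p) ∘ h′ ≡ x → p ∘ h′ ≡ u⁻¹ ∘ x
          u⁻¹-side h′ e₁ = trans (sym (cancelˡ (p ∘ h′) u⁻¹u))
                                 (cong (u⁻¹ ∘_) (trans (sym (assoc u p h′)) e₁))

  idTo : ∀ {A B} → A ≡ B → Hom A B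
  idTo refl = id

  idTo-iso : ∀ {A B} (e : A ≡ B) → IsIso C (idTo e)
  idTo-iso refl = id , identityˡ id , identityˡ id

  subst₂-conjugate : ∀ {A A′ B B′} (e₁ : A ≡ A′) (e₂ : B ≡ B′) (f : Hom A B) (g : Hom A′ B′) →
                     subst₂ Hom e₁ e₂ f ≡ g → idTo e₂ ∘ f ≡ g ∘ idTo e₁
  subst₂-conjugate refl refl f g p = trans (identityˡ f) (trans p (sym (identityʳ g)))

module _ {o ℓ o′ ℓ′} {C : Category o ℓ} {D : Category o′ ℓ′} where
  open Category D
  open CategoryFacts D
  open ≡-Reasoning

  natIso-refl : (F : Functor C D) → NatIso F F
  natIso-refl F = record
    { η = λ _ → id ; η⁻¹ = λ _ → id
    ; isoˡ = λ _ → identityˡ id ; isoʳ = λ _ → identityˡ id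
    ; natural = λ f → trans (identityˡ _) (sym (identityʳ _)) }

  natIso-sym : {F G : Functor C D} → NatIso F G → NatIso G F
  natIso-sym {F} {G} α = record
    { η = η⁻¹ ; η⁻¹ = η ; isoˡ = isoʳ ; isoʳ = isoˡ ; natural = natural⁻¹ }
    where
      open NatIso α
      natural⁻¹ : ∀ {A B} (f : Category.Hom C A B) → η⁻¹ B ∘ F₁ G f ≡ F₁ F f ∘ η⁻¹ A
      natural⁻¹ {A} {B} f = begin
        η⁻¹ B ∘ F₁ G f                     ≡⟨ sym (cancelʳ _ (isoʳ A)) ⟩
        ((η⁻¹ B ∘ F₁ G f) ∘ η A) ∘ η⁻¹ A   ≡⟨ cong (_∘ η⁻¹ A) (assoc _ _ _) ⟩
        (η⁻¹ B ∘ (F₁ G f ∘ η A)) ∘ η⁻¹ A   ≡⟨ cong (λ t → (η⁻¹ B ∘ t) ∘ η⁻¹ A) (sym (natural f)) ⟩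
        (η⁻¹ B ∘ (η B ∘ F₁ F f)) ∘ η⁻¹ A   ≡⟨ cong (_∘ η⁻¹ A) (cancelˡ _ (isoˡ B)) ⟩
        F₁ F f ∘ η⁻¹ A                     ∎

module LimitFacts {o ℓ} (C : Category o ℓ) {J : Category 0ℓ 0ℓ} where
  open Category C
  open CategoryFacts C
  open ≡-Reasoning

  limit-jointly-monic : {D : Functor J C} (Λ : Cone D) → IsLimit Λ →
    ∀ {Z} (h h′ : Hom Z (apex Λ)) → (∀ j → leg Λ j ∘ h ≡ leg Λ j ∘ h′) → h ≡ h′
  limit-jointly-monic {D} Λ lim {Z} h h′ legs≡ =
    trans (unique h legs≡) (sym (unique h′ (λ _ → refl)))
    where
      K : Cone D
      K = record { apex = Z ; leg = λ j → leg Λ j ∘ h′ ; comm = λ u → extendʳ h′ (comm Λ u) }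
      unique = proj₂ (proj₂ (lim K))

  transportCone : {D₁ D₂ : Functor J C} → NatIso D₁ D₂ → Cone D₁ → Cone D₂
  transportCone {D₁} {D₂} α K = record
    { apex = apex K ; leg = λ j → η j ∘ leg K j ; comm = comm′ }
    where
      open NatIso α
      comm′ : ∀ {i j} (u : Category.Hom J i j) → F₁ D₂ u ∘ (η i ∘ leg K i) ≡ η j ∘ leg K j
      comm′ {i} {j} u = begin
        F₁ D₂ u ∘ (η i ∘ leg K i)   ≡⟨ extendʳ (leg K i) (sym (natural u)) ⟩
        (η j ∘ F₁ D₁ u) ∘ leg K i   ≡⟨ assoc _ _ _ ⟩
        η j ∘ (F₁ D₁ u ∘ leg K i)   ≡⟨ cong (η j ∘_) (comm K u) ⟩
        η j ∘ leg K j               ∎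

  limit-transport : {D₁ D₂ : Functor J C} (α : NatIso D₁ D₂) (Λ₁ : Cone D₁) (Λ₂ : Cone D₂)
    (θ : Hom (apex Λ₁) (apex Λ₂)) → IsIso C θ →
    (∀ j → leg Λ₂ j ∘ θ ≡ NatIso.η α j ∘ leg Λ₁ j) → IsLimit Λ₁ → IsLimit Λ₂
  limit-transport α Λ₁ Λ₂ θ (θ⁻¹ , θ⁻¹θ , θθ⁻¹) legs lim K = θ ∘ h , factors , unique
    where
      open NatIso α
      L = lim (transportCone (natIso-sym α) K)
      h = proj₁ L
      h-factors = proj₁ (proj₂ L)
      h-unique = proj₂ (proj₂ L)
      factors : ∀ j → leg Λ₂ j ∘ (θ ∘ h) ≡ leg K j
      factors j = begin
        leg Λ₂ j ∘ (θ ∘ h)          ≡⟨ extendʳ h (legs j) ⟩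
        (η j ∘ leg Λ₁ j) ∘ h        ≡⟨ assoc _ _ _ ⟩
        η j ∘ (leg Λ₁ j ∘ h)        ≡⟨ cong (η j ∘_) (h-factors j) ⟩
        η j ∘ (η⁻¹ j ∘ leg K j)     ≡⟨ cancelˡ _ (isoʳ j) ⟩
        leg K j                     ∎
      legs⁻¹ : ∀ j → leg Λ₁ j ∘ θ⁻¹ ≡ η⁻¹ j ∘ leg Λ₂ j
      legs⁻¹ j = begin
        leg Λ₁ j ∘ θ⁻¹                      ≡⟨ sym (cancelˡ _ (isoˡ j)) ⟩
        η⁻¹ j ∘ (η j ∘ (leg Λ₁ j ∘ θ⁻¹))    ≡⟨ cong (η⁻¹ j ∘_) (sym (assoc _ _ _)) ⟩
        η⁻¹ j ∘ ((η j ∘ leg Λ₁ j) ∘ θ⁻¹)    ≡⟨ cong (λ t → η⁻¹ j ∘ (t ∘ θ⁻¹)) (sym (legs j)) ⟩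
        η⁻¹ j ∘ ((leg Λ₂ j ∘ θ) ∘ θ⁻¹)      ≡⟨ cong (η⁻¹ j ∘_) (cancelʳ _ θθ⁻¹) ⟩
        η⁻¹ j ∘ leg Λ₂ j                    ∎
      unique : ∀ h′ → (∀ j → leg Λ₂ j ∘ h′ ≡ leg K j) → h′ ≡ θ ∘ h
      unique h′ hyp = trans (sym (cancelˡ h′ θθ⁻¹)) (cong (θ ∘_) (h-unique (θ⁻¹ ∘ h′)
        λ j → trans (extendʳ h′ (legs⁻¹ j)) (trans (assoc _ _ _) (cong (η⁻¹ j ∘_) (hyp j)))))

data PairObj : Set where
  first second : PairObj

data PairHom : PairObj → PairObj → Set where
  idP : ∀ {i} → PairHom i i

Pair : Category 0ℓ 0ℓ
Pair = record
  { Obj = PairObj ; Hom = PairHom ; id = idP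
  ; _∘_ = λ { idP idP → idP }
  ; assoc = λ { idP idP idP → refl }
  ; identityˡ = λ { idP → refl }
  ; identityʳ = λ { idP → refl } }

PairFinite : FiniteCategory
PairFinite = record
  { cat = Pair ; size = 2
  ; objFin = mk↔ₛ′ toFin fromFin (λ { zero → refl ; (suc zero) → refl })
                                 (λ { first → refl ; second → refl })
  ; homCount = count
  ; homFin = λ i j → mk↔ₛ′ (homTo i j) (homFrom i j) (to-from i j) (from-to i j) }
  where
    toFin : PairObj → Fin 2
    toFin first = zero
    toFin second = suc zero
    fromFin : Fin 2 → PairObj
    fromFin zero = first
    fromFin (suc zero) = second
    count : PairObj → PairObj → ℕ
    count first first = 1
    count second second = 1
    count first second = 0
    count second first = 0
    homTo : ∀ i j → PairHom i j → Fin (count i j)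
    homTo first .first idP = zero
    homTo second .second idP = zero
    homFrom : ∀ i j → Fin (count i j) → PairHom i j
    homFrom first first zero = idP
    homFrom second second zero = idP
    to-from : ∀ i j y → homTo i j (homFrom i j y) ≡ y
    to-from first first zero = refl
    to-from second second zero = refl
    from-to : ∀ i j x → homFrom i j (homTo i j x) ≡ x
    from-to first .first idP = refl
    from-to second .second idP = refl

data CospanObj : Set where
  left right target : CospanObj

data CospanHom : CospanObj → CospanObj → Set where
  idC : ∀ {i} → CospanHom i i
  fromLeft : CospanHom left target
  fromRight : CospanHom right target

_⊚_ : ∀ {i j k} → CospanHom j k → CospanHom i j → CospanHom i k
idC ⊚ f = f
fromLeft ⊚ idC = fromLeft
fromRight ⊚ idC = fromRight

Cospan : Category 0ℓ 0ℓ
Cospan = record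
  { Obj = CospanObj ; Hom = CospanHom ; id = idC ; _∘_ = _⊚_
  ; assoc = ⊚-assoc ; identityˡ = λ _ → refl ; identityʳ = ⊚-identityʳ }
  where
    ⊚-assoc : ∀ {A B C D} (h : CospanHom C D) (g : CospanHom B C) (f : CospanHom A B) →
              (h ⊚ g) ⊚ f ≡ h ⊚ (g ⊚ f)
    ⊚-assoc idC g f = refl
    ⊚-assoc fromLeft idC idC = refl
    ⊚-assoc fromRight idC idC = refl
    ⊚-identityʳ : ∀ {A B} (f : CospanHom A B) → f ⊚ idC ≡ f
    ⊚-identityʳ idC = refl
    ⊚-identityʳ fromLeft = refl
    ⊚-identityʳ fromRight = refl

CospanFinite : FiniteCategory
CospanFinite = record
  { cat = Cospan ; size = 3
  ; objFin = mk↔ₛ′ toFin fromFin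
      (λ { zero → refl ; (suc zero) → refl ; (suc (suc zero)) → refl })
      (λ { left → refl ; right → refl ; target → refl })
  ; homCount = count
  ; homFin = λ i j → mk↔ₛ′ (homTo i j) (homFrom i j) (to-from i j) (from-to i j) }
  where
    toFin : CospanObj → Fin 3
    toFin left = zero
    toFin right = suc zero
    toFin target = suc (suc zero)
    fromFin : Fin 3 → CospanObj
    fromFin zero = left
    fromFin (suc zero) = right
    fromFin (suc (suc zero)) = target
    count : CospanObj → CospanObj → ℕ
    count left left = 1
    count left target = 1
    count right right = 1
    count right target = 1
    count target target = 1
    count left right = 0
    count right left = 0
    count target left = 0
    count target right = 0
    homTo : ∀ i j → CospanHom i j → Fin (count i j)
    homTo left .left idC = zero
    homTo right .right idC = zero
    homTo target .target idC = zero
    homTo .left .target fromLeft = zero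
    homTo .right .target fromRight = zero
    homFrom : ∀ i j → Fin (count i j) → CospanHom i j
    homFrom left left zero = idC
    homFrom left target zero = fromLeft
    homFrom right right zero = idC
    homFrom right target zero = fromRight
    homFrom target target zero = idC
    to-from : ∀ i j y → homTo i j (homFrom i j y) ≡ y
    to-from left left zero = refl
    to-from left target zero = refl
    to-from right right zero = refl
    to-from right target zero = refl
    to-from target target zero = refl
    from-to : ∀ i j x → homFrom i j (homTo i j x) ≡ x
    from-to left .left idC = refl
    from-to right .right idC = refl
    from-to target .target idC = refl
    from-to .left .target fromLeft = refl
    from-to .right .target fromRight = refl

module LimitShapes {o ℓ} (C : Category o ℓ) where
  open Category C

  pairDiagram : Obj → Obj → Functor Pair C
  pairDiagram X Y = record
    { F₀ = F0 ; F₁ = F1 ; identity = refl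
    ; homomorphism = λ { idP idP → sym (identityˡ id) } }
    where
      F0 : PairObj → Obj
      F0 first = X
      F0 second = Y
      F1 : ∀ {i j} → PairHom i j → Hom (F0 i) (F0 j)
      F1 idP = id

  productCone : ∀ {X Y} → Product C X Y → Cone (pairDiagram X Y)
  productCone {X} {Y} XY = record
    { apex = Product.obj XY ; leg = projection
    ; comm = λ { {i} idP → identityˡ (projection i) } }
    where
      projection : ∀ j → Hom (Product.obj XY) (F₀ (pairDiagram X Y) j)
      projection first = Product.π₁ XY
      projection second = Product.π₂ XY

  product-isLimit : ∀ {X Y} (XY : Product C X Y) → IsLimit (productCone XY)
  product-isLimit XY K = proj₁ U , (λ { first → π₁-factor ; second → π₂-factor }) ,
                         λ h′ hyp → unique h′ (hyp first) (hyp second)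
    where
      U = Product.universal XY (leg K first) (leg K second)
      π₁-factor = proj₁ (proj₂ U)
      π₂-factor = proj₁ (proj₂ (proj₂ U))
      unique = proj₂ (proj₂ (proj₂ U))

  cospanDiagram : ∀ {A B X} → Hom A X → Hom B X → Functor Cospan C
  cospanDiagram {A} {B} {X} f g = record
    { F₀ = F0 ; F₁ = F1 ; identity = refl ; homomorphism = F1-∘ }
    where
      F0 : CospanObj → Obj
      F0 left = A
      F0 right = B
      F0 target = X
      F1 : ∀ {i j} → CospanHom i j → Hom (F0 i) (F0 j)
      F1 idC = id
      F1 fromLeft = f
      F1 fromRight = g
      F1-∘ : ∀ {i j k} (v : CospanHom j k) (u : CospanHom i j) → F1 (v ⊚ u) ≡ F1 v ∘ F1 u
      F1-∘ idC u = sym (identityˡ _)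
      F1-∘ fromLeft idC = sym (identityʳ _)
      F1-∘ fromRight idC = sym (identityʳ _)

  squareCone : ∀ {P A B X} {p : Hom P A} {q : Hom P B} {f : Hom A X} {g : Hom B X} →
               f ∘ p ≡ g ∘ q → Cone (cospanDiagram f g)
  squareCone {P} {p = p} {q} {f} {g} e = record
    { apex = P ; leg = λ { left → p ; right → q ; target → f ∘ p }
    ; comm = λ { {left} idC → identityˡ _ ; {right} idC → identityˡ _
               ; {target} idC → identityˡ _ ; fromLeft → refl ; fromRight → sym e } }

  module _ {D : Functor Cospan C} where
    private
      idC-leg : ∀ {Z i} (h : Hom Z (F₀ D i)) → F₁ D (idC {i}) ∘ h ≡ h
      idC-leg h = trans (cong (_∘ h) (identity D)) (identityˡ h)

      target-leg : (Λ : Cone D) → ∀ {Z} (h : Hom Z (apex Λ)) →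
                   leg Λ target ∘ h ≡ F₁ D fromLeft ∘ (leg Λ left ∘ h)
      target-leg Λ h = trans (cong (_∘ h) (sym (comm Λ fromLeft))) (assoc _ _ _)

    limit⇒pullback : (Λ : Cone D) → IsLimit Λ →
      IsPullbackSquare C (leg Λ left) (leg Λ right) (F₁ D fromLeft) (F₁ D fromRight)
    limit⇒pullback Λ lim = record
      { commute = trans (comm Λ fromLeft) (sym (comm Λ fromRight))
      ; universal = λ {Z} x y e → let
          K : Cone D
          K = record { apex = Z ; leg = λ { left → x ; right → y ; target → F₁ D fromLeft ∘ x }
                     ; comm = λ { {left} idC → idC-leg x ; {right} idC → idC-leg y
                                ; {target} idC → idC-leg _ ; fromLeft → refl
                                ; fromRight → sym e } }
          L = lim K
          in proj₁ L , proj₁ (proj₂ L) left , proj₁ (proj₂ L) right ,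
             λ h′ p q → proj₂ (proj₂ L) h′ λ { left → p ; right → q
               ; target → trans (target-leg Λ h′) (cong (F₁ D fromLeft ∘_) p) } }

    pullback⇒limit : (Λ : Cone D) →
      IsPullbackSquare C (leg Λ left) (leg Λ right) (F₁ D fromLeft) (F₁ D fromRight) →
      IsLimit Λ
    pullback⇒limit Λ sq K = h , (λ { left → p ; right → q
        ; target → trans (target-leg Λ h) (trans (cong (F₁ D fromLeft ∘_) p) (comm K fromLeft)) }) ,
      λ h′ hyp → unique h′ (hyp left) (hyp right)
      where
        U = IsPullbackSquare.universal sq (leg K left) (leg K right)
              (trans (comm K fromLeft) (sym (comm K fromRight)))
        h = proj₁ U
        p = proj₁ (proj₂ U)
        q = proj₁ (proj₂ (proj₂ U))
        unique = proj₂ (proj₂ (proj₂ U))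

  pullback-exists : HasFiniteLimits C → ∀ {A B X} (f : Hom A X) (g : Hom B X) →
    Σ Obj λ P → Σ (Hom P A) λ p → Σ (Hom P B) λ q → IsPullbackSquare C p q f g
  pullback-exists limits f g = apex L , leg L left , leg L right , limit⇒pullback L lim
    where
      L = proj₁ (limits CospanFinite (cospanDiagram f g))
      lim = proj₂ (limits CospanFinite (cospanDiagram f g))

module FunctorFacts {o ℓ o′ ℓ′} {B : Category o ℓ} {C : Category o′ ℓ′}
                    (F : Functor B C) where
  private
    module B = Category B
    module C = Category C
    module SB = LimitShapes B
    module SC = LimitShapes C
  open CategoryFacts C
  open ≡-Reasoning

  map-∘ : ∀ {X Y Z} {g : B.Hom Y Z} {f : B.Hom X Y} {h : B.Hom X Z} →
          g B.∘ f ≡ h → F₁ F g C.∘ F₁ F f ≡ F₁ F h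
  map-∘ e = trans (sym (homomorphism F _ _)) (cong (F₁ F) e)

  faithful-reflects-mono : (∀ {X Y} (f g : B.Hom X Y) → F₁ F f ≡ F₁ F g → f ≡ g) →
    ∀ {X Y} (f : B.Hom X Y) → IsMono C (F₁ F f) → IsMono B f
  faithful-reflects-mono faithful f Ff-mono g h fg≡fh = faithful g h (Ff-mono _ _ (begin
    F₁ F f C.∘ F₁ F g   ≡⟨ map-∘ fg≡fh ⟩
    F₁ F (f B.∘ h)      ≡⟨ homomorphism F f h ⟩
    F₁ F f C.∘ F₁ F h   ∎))

  reflects-pullbacks : ReflectsFiniteLimits F →
    ∀ {P X Y Z} {p : B.Hom P X} {q : B.Hom P Y} {f : B.Hom X Z} {g : B.Hom Y Z} →
    f B.∘ p ≡ g B.∘ q →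
    IsPullbackSquare C (F₁ F p) (F₁ F q) (F₁ F f) (F₁ F g) → IsPullbackSquare B p q f g
  reflects-pullbacks reflects {f = f} {g} e sq =
    SB.limit⇒pullback (SB.squareCone e)
      (reflects CospanFinite (SB.cospanDiagram f g) (SB.squareCone e)
        (SC.pullback⇒limit (mapCone F (SB.squareCone e)) sq))

  module Preserving (preserves : PreservesFiniteLimits F) where

    preserves-pullbacks :
      ∀ {P X Y Z} {p : B.Hom P X} {q : B.Hom P Y} {f : B.Hom X Z} {g : B.Hom Y Z} →
      IsPullbackSquare B p q f g → IsPullbackSquare C (F₁ F p) (F₁ F q) (F₁ F f) (F₁ F g)
    preserves-pullbacks {f = f} {g} sq =
      SC.limit⇒pullback (mapCone F (SB.squareCone commute))
        (preserves CospanFinite (SB.cospanDiagram f g) (SB.squareCone commute)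
          (SB.pullback⇒limit (SB.squareCone commute) sq))
      where open IsPullbackSquare sq

    product-jointly-monic : ∀ {X Y} (XY : Product B X Y) {Z}
      (h h′ : C.Hom Z (F₀ F (Product.obj XY))) →
      F₁ F (Product.π₁ XY) C.∘ h ≡ F₁ F (Product.π₁ XY) C.∘ h′ →
      F₁ F (Product.π₂ XY) C.∘ h ≡ F₁ F (Product.π₂ XY) C.∘ h′ → h ≡ h′
    product-jointly-monic {X} {Y} XY h h′ e₁ e₂ =
      LimitFacts.limit-jointly-monic C (mapCone F (SB.productCone XY))
        (preserves PairFinite (SB.pairDiagram X Y) (SB.productCone XY) (SB.product-isLimit XY))
        h h′ (λ { first → e₁ ; second → e₂ })

    preserves-classifying-square : ∀ {X Y Q XY XQ R E}
      {p₁ : B.Hom XY X} {p₂ : B.Hom XY Y} {q₁ : B.Hom XQ X} {q₂ : B.Hom XQ Q}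
      {χ : B.Hom Y Q} {r : B.Hom R XY} {m : B.Hom E XQ} →
      PullbackAlongPair B p₁ p₂ q₁ q₂ χ r m →
      PullbackAlongPair C (F₁ F p₁) (F₁ F p₂) (F₁ F q₁) (F₁ F q₂) (F₁ F χ) (F₁ F r) (F₁ F m)
    preserves-classifying-square (k , (k₁ , k₂) , s , sq) =
      F₁ F k , (map-∘ k₁ , trans (map-∘ k₂) (homomorphism F _ _)) , F₁ F s , preserves-pullbacks sq

  module Conservative (limits : HasFiniteLimits B) (preserves : PreservesFiniteLimits F)
    (conservative : ∀ {X Y} (f : B.Hom X Y) → IsIso C (F₁ F f) → IsIso B f) where
    open Preserving preserves

    -- Λ is compared with a chosen limit L; the comparison becomes invertible
    -- under F (both images are limits), hence is invertible in B.
    reflects-limits : ReflectsFiniteLimits F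
    reflects-limits J D Λ FΛ-lim =
      LimitFacts.limit-transport B (natIso-refl D) L Λ c⁻¹ (c , c⁻¹-inverse) legs L-lim
      where
        L = proj₁ (limits J D)
        L-lim = proj₂ (limits J D)
        c = proj₁ (L-lim Λ)
        c-legs : ∀ j → leg L j B.∘ c ≡ leg Λ j
        c-legs = proj₁ (proj₂ (L-lim Λ))
        d = proj₁ (FΛ-lim (mapCone F L))
        d-legs : ∀ j → F₁ F (leg Λ j) C.∘ d ≡ F₁ F (leg L j)
        d-legs = proj₁ (proj₂ (FΛ-lim (mapCone F L)))
        Fc-legs : ∀ j → F₁ F (leg L j) C.∘ F₁ F c ≡ F₁ F (leg Λ j)
        Fc-legs j = map-∘ (c-legs j)
        d∘Fc : d C.∘ F₁ F c ≡ C.id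
        d∘Fc = LimitFacts.limit-jointly-monic C (mapCone F Λ) FΛ-lim _ _ λ j → begin
          F₁ F (leg Λ j) C.∘ (d C.∘ F₁ F c)   ≡⟨ extendʳ (F₁ F c) (d-legs j) ⟩
          F₁ F (leg L j) C.∘ F₁ F c           ≡⟨ Fc-legs j ⟩
          F₁ F (leg Λ j)                      ≡⟨ sym (C.identityʳ _) ⟩
          F₁ F (leg Λ j) C.∘ C.id             ∎
        Fc∘d : F₁ F c C.∘ d ≡ C.id
        Fc∘d = LimitFacts.limit-jointly-monic C (mapCone F L)
                 (preserves J D L L-lim) _ _ λ j → begin
          F₁ F (leg L j) C.∘ (F₁ F c C.∘ d)   ≡⟨ extendʳ d (Fc-legs j) ⟩
          F₁ F (leg Λ j) C.∘ d                ≡⟨ d-legs j ⟩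
          F₁ F (leg L j)                      ≡⟨ sym (C.identityʳ _) ⟩
          F₁ F (leg L j) C.∘ C.id             ∎
        c-iso = conservative c (d , d∘Fc , Fc∘d)
        c⁻¹ = proj₁ c-iso
        c⁻¹-inverse = proj₂ (proj₂ c-iso) , proj₁ (proj₂ c-iso)
        legs : ∀ j → leg Λ j B.∘ c⁻¹ ≡ B.id B.∘ leg L j
        legs j = trans (cong (B._∘ c⁻¹) (sym (c-legs j)))
                   (trans (CategoryFacts.cancelʳ B _ (proj₂ (proj₂ c-iso))) (sym (B.identityˡ _)))

    -- If F r factors through the mono F a in C, then r factors through a in B:
    -- the pullback u of a along r becomes split epi, hence invertible, under F.
    factor-through-mono : ∀ {R P Y} (r : B.Hom R Y) (a : B.Hom P Y) → IsMono C (F₁ F a) →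
      (φ : C.Hom (F₀ F R) (F₀ F P)) → F₁ F a C.∘ φ ≡ F₁ F r →
      Σ (B.Hom R P) λ t → a B.∘ t ≡ r
    factor-through-mono r a Fa-mono φ aφ≡r with SB.pullback-exists limits r a
    ... | _ , u , v , sq = v B.∘ u⁻¹ , a∘t≡r
      where
        Fsq = preserves-pullbacks sq
        Ψ = IsPullbackSquare.universal Fsq C.id φ (trans (C.identityʳ _) (sym aφ≡r))
        ψ = proj₁ Ψ
        Fu∘ψ : F₁ F u C.∘ ψ ≡ C.id
        Fu∘ψ = proj₁ (proj₂ Ψ)
        Fv∘ψ : F₁ F v C.∘ ψ ≡ φ
        Fv∘ψ = proj₁ (proj₂ (proj₂ Ψ))
        φ∘Fu : φ C.∘ F₁ F u ≡ F₁ F v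
        φ∘Fu = Fa-mono _ _ (begin
          F₁ F a C.∘ (φ C.∘ F₁ F u)   ≡⟨ extendʳ (F₁ F u) aφ≡r ⟩
          F₁ F r C.∘ F₁ F u           ≡⟨ IsPullbackSquare.commute Fsq ⟩
          F₁ F a C.∘ F₁ F v           ∎)
        ψ∘Fu : ψ C.∘ F₁ F u ≡ C.id
        ψ∘Fu = pullback-jointly-monic Fsq _ _
          (trans (extendʳ (F₁ F u) Fu∘ψ) (trans (C.identityˡ _) (sym (C.identityʳ _))))
          (trans (extendʳ (F₁ F u) Fv∘ψ) (trans φ∘Fu (sym (C.identityʳ _))))
        u-iso = conservative u (ψ , ψ∘Fu , Fu∘ψ)
        u⁻¹ = proj₁ u-iso
        a∘t≡r : a B.∘ (v B.∘ u⁻¹) ≡ r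
        a∘t≡r = begin
          a B.∘ (v B.∘ u⁻¹)   ≡⟨ sym (B.assoc _ _ _) ⟩
          (a B.∘ v) B.∘ u⁻¹   ≡⟨ cong (B._∘ u⁻¹) (sym (IsPullbackSquare.commute sq)) ⟩
          (r B.∘ u) B.∘ u⁻¹   ≡⟨ CategoryFacts.cancelʳ B r (proj₂ (proj₂ u-iso)) ⟩
          r                   ∎

    lift-pullback : ∀ {R Y Z E} (r : B.Hom R Y) (k : B.Hom Y Z) (m : B.Hom E Z) →
      IsMono C (F₁ F m) → (s′ : C.Hom (F₀ F R) (F₀ F E)) →
      IsPullbackSquare C (F₁ F r) s′ (F₁ F k) (F₁ F m) →
      Σ (B.Hom R E) λ s → IsPullbackSquare B r s k m
    lift-pullback r k m Fm-mono s′ sq′ with SB.pullback-exists limits k m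
    ... | _ , a , b , sq = b B.∘ t ,
          reflects-pullbacks reflects-limits square
            (subst (λ x → IsPullbackSquare C (F₁ F r) x (F₁ F k) (F₁ F m)) (sym Fs≡s′) sq′)
      where
        Fsq = preserves-pullbacks sq
        Φ = IsPullbackSquare.universal Fsq (F₁ F r) s′ (IsPullbackSquare.commute sq′)
        factorisation = factor-through-mono r a (pullback-of-mono Fsq Fm-mono)
                          (proj₁ Φ) (proj₁ (proj₂ Φ))
        t = proj₁ factorisation
        square : k B.∘ r ≡ m B.∘ (b B.∘ t)
        square = begin
          k B.∘ r             ≡⟨ cong (k B.∘_) (sym (proj₂ factorisation)) ⟩
          k B.∘ (a B.∘ t)     ≡⟨ CategoryFacts.extendʳ B t (IsPullbackSquare.commute sq) ⟩
          (m B.∘ b) B.∘ t     ≡⟨ B.assoc _ _ _ ⟩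
          m B.∘ (b B.∘ t)     ∎
        Fs≡s′ : F₁ F (b B.∘ t) ≡ s′
        Fs≡s′ = Fm-mono _ _ (begin
          F₁ F m C.∘ F₁ F (b B.∘ t)   ≡⟨ map-∘ (sym square) ⟩
          F₁ F (k B.∘ r)              ≡⟨ homomorphism F k r ⟩
          F₁ F k C.∘ F₁ F r           ≡⟨ IsPullbackSquare.commute sq′ ⟩
          F₁ F m C.∘ s′               ∎)

    reflect-classifying-square : ∀ {X Y Q} (XQ : Product B X Q) (XY : Product B X Y)
      {R E} {χ : B.Hom Y Q} {r : B.Hom R (Product.obj XY)} {m : B.Hom E (Product.obj XQ)} →
      IsMono C (F₁ F m) →
      PullbackAlongPair C (F₁ F (Product.π₁ XY)) (F₁ F (Product.π₂ XY))
        (F₁ F (Product.π₁ XQ)) (F₁ F (Product.π₂ XQ)) (F₁ F χ) (F₁ F r) (F₁ F m) →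
      PullbackAlongPair B (Product.π₁ XY) (Product.π₂ XY)
        (Product.π₁ XQ) (Product.π₂ XQ) χ r m
    reflect-classifying-square XQ XY {χ = χ} {r} {m} Fm-mono (k′ , (k′₁ , k′₂) , s′ , sq′) =
      k , (k₁ , k₂) ,
      lift-pullback r k m Fm-mono s′
        (subst (λ x → IsPullbackSquare C (F₁ F r) s′ x (F₁ F m)) (sym Fk≡k′) sq′)
      where
        K = Product.universal XQ (Product.π₁ XY) (χ B.∘ Product.π₂ XY)
        k = proj₁ K
        k₁ = proj₁ (proj₂ K)
        k₂ = proj₁ (proj₂ (proj₂ K))
        Fk≡k′ : F₁ F k ≡ k′
        Fk≡k′ = product-jointly-monic XQ _ _ (trans (map-∘ k₁) (sym k′₁))
                  (trans (map-∘ k₂) (trans (homomorphism F _ _) (sym k′₂)))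

-- An equivalence of preorders, given by monotone maps φ and ψ with
-- x ≈ ψ (φ x) and y ≈ φ (ψ y), makes φ both left and right adjoint to ψ;
-- hence φ preserves least elements, binary joins and complements.
module PreorderEquivalence {a r a′ r′} {S : Set a} {S′ : Set a′}
  (_≤_ : S → S → Set r) (_≤′_ : S′ → S′ → Set r′)
  (≤-trans : ∀ {x y z} → x ≤ y → y ≤ z → x ≤ z)
  (≤′-trans : ∀ {x y z} → x ≤′ y → y ≤′ z → x ≤′ z)
  (φ : S → S′) (ψ : S′ → S)
  (φ-mono : ∀ {x y} → x ≤ y → φ x ≤′ φ y)
  (ψ-mono : ∀ {x y} → x ≤′ y → ψ x ≤ ψ y)
  (unit : ∀ x → x ≤ ψ (φ x)) (unit⁻¹ : ∀ x → ψ (φ x) ≤ x)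
  (counit : ∀ y → φ (ψ y) ≤′ y) (counit⁻¹ : ∀ y → y ≤′ φ (ψ y)) where

  φ⊣ψ : ∀ {x y} → φ x ≤′ y → x ≤ ψ y
  φ⊣ψ h = ≤-trans (unit _) (ψ-mono h)

  φ⊣ψ⁻¹ : ∀ {x y} → x ≤ ψ y → φ x ≤′ y
  φ⊣ψ⁻¹ h = ≤′-trans (φ-mono h) (counit _)

  ψ⊣φ : ∀ {x y} → ψ y ≤ x → y ≤′ φ x
  ψ⊣φ h = ≤′-trans (counit⁻¹ _) (φ-mono h)

  ψ⊣φ⁻¹ : ∀ {x y} → y ≤′ φ x → ψ y ≤ x
  ψ⊣φ⁻¹ h = ≤-trans (ψ-mono h) (unit⁻¹ _)

  preserves-least : ∀ z → IsLeast _≤_ z → IsLeast _≤′_ (φ z)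
  preserves-least z least b = φ⊣ψ⁻¹ (least (ψ b))

  preserves-join : ∀ x y j → IsJoin _≤_ x y j → IsJoin _≤′_ (φ x) (φ y) (φ j)
  preserves-join x y j (x≤j , y≤j , lub) =
    φ-mono x≤j , φ-mono y≤j , λ c p q → φ⊣ψ⁻¹ (lub (ψ c) (φ⊣ψ p) (φ⊣ψ q))

  -- a meet of φ x, φ c is carried by ψ to a meet of x, c (and dually for joins)
  preserves-complement : ∀ x c → IsComplement _≤_ x c → IsComplement _≤′_ (φ x) (φ c)
  preserves-complement x c (meet-least , join-greatest) =
    (λ m (m≤x , m≤c , glb) →
       let ψm-least = meet-least (ψ m)
             (ψ⊣φ⁻¹ m≤x , ψ⊣φ⁻¹ m≤c , λ d p q → φ⊣ψ (glb (φ d) (φ-mono p) (φ-mono q)))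
       in λ b → ≤′-trans (counit⁻¹ m) (φ⊣ψ⁻¹ (ψm-least (ψ b)))) ,
    (λ j (x≤j , c≤j , lub) →
       let ψj-greatest = join-greatest (ψ j)
             (φ⊣ψ x≤j , φ⊣ψ c≤j , λ d p q → ψ⊣φ⁻¹ (lub (φ d) (φ-mono p) (φ-mono q)))
       in λ b → ≤′-trans (ψ⊣φ (ψj-greatest (ψ b))) (counit j))

-- A functor T naturally isomorphic to the identity is a Boolean (in
-- particular Heyting) functor: it acts by conjugation with ι, so it
-- preserves monos, covers and limits, and on each Sub(X) it is an order
-- isomorphism onto Sub(T X) compatible with pullback.
module IsomorphicToIdentity {o ℓ} {C : Category o ℓ} (T : Functor C C) (ι : NatIso idF T) where
  open Category C
  open CategoryFacts C
  open NatIso ι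
  open ≡-Reasoning

  η-iso : ∀ {A} → IsIso C (η A)
  η-iso {A} = η⁻¹ A , isoˡ A , isoʳ A

  η⁻¹-iso : ∀ {A} → IsIso C (η⁻¹ A)
  η⁻¹-iso {A} = η A , isoʳ A , isoˡ A

  η⁻¹-natural : ∀ {A B} (f : Hom A B) → η⁻¹ B ∘ F₁ T f ≡ f ∘ η⁻¹ A
  η⁻¹-natural = NatIso.natural (natIso-sym ι)

  conjugate : ∀ {A B} (f : Hom A B) → F₁ T f ≡ (η B ∘ f) ∘ η⁻¹ A
  conjugate {A} f = sym (trans (cong (_∘ η⁻¹ A) (natural f)) (cancelʳ (F₁ T f) (isoʳ A)))

  preserves-mono : ∀ {A B} (f : Hom A B) → IsMono C f → IsMono C (F₁ T f)
  preserves-mono f f-mono = subst (IsMono C) (sym (conjugate f))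
    (∘-mono (∘-mono (iso⇒mono η-iso) f-mono) (iso⇒mono η⁻¹-iso))

  preserves-cover : ∀ {A B} (f : Hom A B) → IsCover C f → IsCover C (F₁ T f)
  preserves-cover f f-cover = subst (IsCover C) (sym (conjugate f))
    (cover-∘-iso (iso-∘-cover η-iso f-cover) η⁻¹-iso)

  preserves-limits : PreservesFiniteLimits T
  preserves-limits J D Λ lim =
    LimitFacts.limit-transport C ιD Λ (mapCone T Λ) (η (apex Λ)) η-iso
      (λ j → sym (natural (leg Λ j))) lim
    where
      ιD : NatIso D (T ∘F D)
      ιD = record { η = λ j → η (F₀ D j) ; η⁻¹ = λ j → η⁻¹ (F₀ D j)
                  ; isoˡ = λ j → isoˡ _ ; isoʳ = λ j → isoʳ _
                  ; natural = λ u → natural (F₁ D u) }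

  φ : ∀ {X} → Sub C X → Sub C (F₀ T X)
  φ = mapSub T preserves-mono

  ψ : ∀ {X} → Sub C (F₀ T X) → Sub C X
  ψ {X} b = sub (dom b) (η⁻¹ X ∘ arr b) (∘-mono (iso⇒mono η⁻¹-iso) (mono b))

  φ-mono : ∀ {X} {a b : Sub C X} → _≤S_ C a b → _≤S_ C (φ a) (φ b)
  φ-mono (h , e) = F₁ T h , trans (sym (homomorphism T _ _)) (cong (F₁ T) e)

  ψ-mono : ∀ {X} {a b : Sub C (F₀ T X)} → _≤S_ C a b → _≤S_ C (ψ a) (ψ b)
  ψ-mono (h , e) = h , trans (assoc _ _ _) (cong (η⁻¹ _ ∘_) e)

  unit : ∀ {X} (a : Sub C X) → _≤S_ C a (ψ (φ a))
  unit a = η (dom a) ,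
    trans (assoc _ _ _) (trans (cong (η⁻¹ _ ∘_) (sym (natural (arr a)))) (cancelˡ _ (isoˡ _)))

  unit⁻¹ : ∀ {X} (a : Sub C X) → _≤S_ C (ψ (φ a)) a
  unit⁻¹ a = η⁻¹ (dom a) , sym (η⁻¹-natural (arr a))

  -- T (η⁻¹ ∘ b) ∘ η ≡ b: naturality of ι at η⁻¹ ∘ b
  φψ-arr : ∀ {X} (b : Sub C (F₀ T X)) → F₁ T (η⁻¹ X ∘ arr b) ∘ η (dom b) ≡ arr b
  φψ-arr {X} b = trans (sym (natural _)) (cancelˡ _ (isoʳ X))

  counit : ∀ {X} (b : Sub C (F₀ T X)) → _≤S_ C (φ (ψ b)) b
  counit b = η⁻¹ (dom b) ,
    trans (cong (_∘ η⁻¹ (dom b)) (sym (φψ-arr b))) (cancelʳ _ (isoʳ (dom b)))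

  counit⁻¹ : ∀ {X} (b : Sub C (F₀ T X)) → _≤S_ C b (φ (ψ b))
  counit⁻¹ b = η (dom b) , φψ-arr b

  module Sub≃ (X : Obj) = PreorderEquivalence (_≤S_ C {X}) (_≤S_ C {F₀ T X})
    (λ {a b c} → ≤S-trans {X} {a} {b} {c}) (λ {a b c} → ≤S-trans {F₀ T X} {a} {b} {c})
    φ ψ (λ {a b} → φ-mono {X} {a} {b}) (λ {a b} → ψ-mono {X} {a} {b})
    unit unit⁻¹ counit counit⁻¹

  ψ-pullback : ∀ {X Y} (f : Hom X Y) (b : Sub C (F₀ T Y)) (p : Sub C (F₀ T X)) →
               PullbackOf C (F₁ T f) b p → PullbackOf C f (ψ b) (ψ p)
  ψ-pullback f b p (q , sq) =
    q , pullback-transport η⁻¹-iso (iso⇒mono η⁻¹-iso) (sym (η⁻¹-natural f)) sq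

  preserves-image : ∀ {A X} (f : Hom A X) (m : Sub C X) → IsImage C f m →
                    IsImage C (F₁ T f) (φ m)
  preserves-image {A} {X} f m ((g , mg≡f) , minimal) =
    (F₁ T g , trans (sym (homomorphism T _ _)) (cong (F₁ T) mg≡f)) ,
    λ n (g′ , ng′≡Tf) → Sub≃.φ⊣ψ⁻¹ X {m} {n} (minimal (ψ n) (g′ ∘ η A , ψn-factors n g′ ng′≡Tf))
    where
      ψn-factors : ∀ n g′ → arr n ∘ g′ ≡ F₁ T f → (η⁻¹ X ∘ arr n) ∘ (g′ ∘ η A) ≡ f
      ψn-factors n g′ e = begin
        (η⁻¹ X ∘ arr n) ∘ (g′ ∘ η A)   ≡⟨ assoc _ _ _ ⟩
        η⁻¹ X ∘ (arr n ∘ (g′ ∘ η A))   ≡⟨ cong (η⁻¹ X ∘_) (extendʳ (η A) e) ⟩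
        η⁻¹ X ∘ (F₁ T f ∘ η A)         ≡⟨ cong (η⁻¹ X ∘_) (sym (natural f)) ⟩
        η⁻¹ X ∘ (η X ∘ f)              ≡⟨ cancelˡ f (isoˡ X) ⟩
        f                              ∎

  preserves-exists : ∀ {X Y} (f : Hom X Y) (a : Sub C X) (e : Sub C Y) → IsExists C f a e →
                     IsExists C (F₁ T f) (φ a) (φ e)
  preserves-exists {X} {Y} f a e ∃f b p pb =
    (λ h → Sub≃.φ⊣ψ⁻¹ X {a} {p} (proj₁ adj (Sub≃.φ⊣ψ Y {e} {b} h))) ,
    (λ h → Sub≃.φ⊣ψ⁻¹ Y {e} {b} (proj₂ adj (Sub≃.φ⊣ψ X {a} {p} h)))
    where adj = ∃f (ψ b) (ψ p) (ψ-pullback f b p pb)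

  preserves-forall : ∀ {X Y} (f : Hom X Y) (a : Sub C X) (q : Sub C Y) → IsForall C f a q →
                     IsForall C (F₁ T f) (φ a) (φ q)
  preserves-forall {X} {Y} f a q ∀f b p pb =
    (λ h → Sub≃.ψ⊣φ Y {q} {b} (proj₁ adj (Sub≃.ψ⊣φ⁻¹ X {a} {p} h))) ,
    (λ h → Sub≃.ψ⊣φ X {a} {p} (proj₂ adj (Sub≃.ψ⊣φ⁻¹ Y {q} {b} h)))
    where adj = ∀f (ψ b) (ψ p) (ψ-pullback f b p pb)

  heyting : HeytingFunctor T
  heyting = record
    { preservesFiniteLimits = preserves-limits
    ; preservesMono = preserves-mono
    ; preservesCovers = preserves-cover
    ; preservesImages = preserves-image
    ; preservesBottom = λ z → Sub≃.preserves-least _ z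
    ; preservesJoin = λ a b j → Sub≃.preserves-join _ a b j
    ; preservesExists = preserves-exists
    ; preservesForall = preserves-forall }

  boolean : BooleanFunctor T
  boolean = record
    { heyting = heyting
    ; preservesComplement = λ a c → Sub≃.preserves-complement _ a c }

module IMLUFacts {o ℓ} (𝓒 : IMLU o ℓ) where
  open IMLU 𝓒
  private
    module MC = Category M
  open HeytingFunctor I-heyting using (preservesMono; preservesFiniteLimits)
  open FunctorFacts I
  open Preserving preservesFiniteLimits
  open Conservative (HeytingCategory.finiteLimits heytingN) preservesFiniteLimits I-conservative

  mono-iff : ∀ {A B} (f : Category.Hom N A B) →
             (IsMono N f → IsMono M (F₁ I f)) × (IsMono M (F₁ I f) → IsMono N f)
  mono-iff f = preservesMono f , faithful-reflects-mono I-faithful f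

  I-reflects-limits : ReflectsFiniteLimits I
  I-reflects-limits = reflects-limits

  power-object : ∀ A → IsPowerObject N (F₀ TN A) (F₀ P A) (prodTP A) (m⊆T A)
  power-object A = faithful-reflects-mono I-faithful (m⊆T A) (m⊆T-mono A) , classify
    where
      Classifies : ∀ {B} (XB : Product N (F₀ TN A) B) {R} →
                   Category.Hom N R (Product.obj XB) → Category.Hom N B (F₀ P A) → Set (o ⊔ ℓ)
      Classifies XB r χ = PullbackAlongPair N (Product.π₁ XB) (Product.π₂ XB)
        (Product.π₁ (prodTP A)) (Product.π₂ (prodTP A)) χ r (m⊆T A)

      classify : ∀ B (XB : Product N (F₀ TN A) B) {R} (r : Category.Hom N R (Product.obj XB)) →
        IsMono N r →
        Σ (Category.Hom N B (F₀ P A)) λ χ → Classifies XB r χ × (∀ χ′ → Classifies XB r χ′ → χ′ ≡ χ)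
      classify B XB r r-mono =
        χ , reflect-classifying-square (prodTP A) XB (m⊆T-mono A) (proj₁ (proj₂ comp)) ,
        λ χ′ sq′ → I-faithful χ′ χ (proj₂ (proj₂ comp) (F₁ I χ′) (preserves-classifying-square sq′))
        where
          comp = comprehension A B XB r (preservesMono r r-mono)
          χ = proj₁ comp

  open Restricts T-restricts
  open CategoryFacts M using (idTo; idTo-iso; subst₂-conjugate)

  restriction-square : ∀ {A B} (f : Category.Hom N A B) →
    idTo (obj-eq B) MC.∘ F₁ T (F₁ I f) ≡ F₁ I (F₁ TN f) MC.∘ idTo (obj-eq A)
  restriction-square f = subst₂-conjugate (obj-eq _) (obj-eq _) _ _ (hom-eq f)

  restrictionIso : ∀ {J : Category 0ℓ 0ℓ} (D : Functor J N) →
                   NatIso (T ∘F (I ∘F D)) (I ∘F (TN ∘F D))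
  restrictionIso D = record
    { η = λ j → idTo (obj-eq (F₀ D j)) ; η⁻¹ = λ j → proj₁ (idTo-iso (obj-eq (F₀ D j)))
    ; isoˡ = λ j → proj₁ (proj₂ (idTo-iso (obj-eq (F₀ D j))))
    ; isoʳ = λ j → proj₂ (proj₂ (idTo-iso (obj-eq (F₀ D j))))
    ; natural = λ u → restriction-square (F₁ D u) }

  TN-preserves-limits : PreservesFiniteLimits TN
  TN-preserves-limits J D Λ lim = I-reflects-limits J (TN ∘F D) (mapCone TN Λ)
    (LimitFacts.limit-transport M (restrictionIso D) (mapCone T (mapCone I Λ))
      (mapCone I (mapCone TN Λ)) (idTo (obj-eq (apex Λ))) (idTo-iso (obj-eq (apex Λ)))
      (λ j → sym (restriction-square (leg Λ j)))
      (IsomorphicToIdentity.preserves-limits T ι J (I ∘F D) (mapCone I Λ)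
        (preservesFiniteLimits J D Λ lim)))

mainTheorem13 : ∀ {o ℓ} (𝓒 : IMLU o ℓ) →
    let open IMLU 𝓒 in
    (∀ {A B} (f : Category.Hom N A B) →
    (IsMono N f → IsMono M (F₁ I f)) × (IsMono M (F₁ I f) → IsMono N f)) ×
    ReflectsFiniteLimits I ×
    (∀ A → IsPowerObject N (F₀ TN A) (F₀ P A) (prodTP A) (m⊆T A)) ×
    (HeytingFunctor T × (IsBoolean M → IsBoolean N → BooleanFunctor T)) ×
    PreservesFiniteLimits TN
mainTheorem13 𝓒 =
  mono-iff , I-reflects-limits , power-object ,
  -- T ≅ id is Boolean outright, without using Booleanness of M or N
  (heyting , λ _ _ → boolean) ,
  TN-preserves-limits
  where
    open IMLUFacts 𝓒
    open IsomorphicToIdentity (IMLU.T 𝓒) (IMLU.ι 𝓒) using (heyting; boolean)
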